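{- Let $n \geq 4$ be an integer and let $S$ be the sequence obtained from the canonical recycle sequence $\mathcal{R}_{n-1}$ by moving its first two entries to the end (i.e. if $\mathcal{R}_{n-1} = r_1, r_2, \ldots, r_k$ then $S = r_3, \ldots, r_k, r_1, r_2$). Then for every $m \in \{2,3,\ldots,n\}$, the sequence $\mathrm{rewind}_{m}(S)$ (formed with parameter $n$) is a Hamilton sequence for the restricted incomplete rotator graph $\mathrm{Rot}_n(R, m)$ with $R = \{n-2, n-1, n\}$.
   Context: For $n \geq 1$, $\Pi_n$ denotes the set of strings $a_1 \cdots a_n$ that are permutations of $\{1,\ldots,n\}$. For $2 \le r \le n$, the prefix-rotation $\sigma_r$ maps $a_1 \cdots a_n$ to $a_2 \cdots a_r a_1 a_{r+1} \cdots a_n$. For $R \subseteq \{2,\ldots,n\}$ and $m \in \{1,\ldots,n\}$, the restricted incomplete rotator graph $\mathrm{Rot}_n(R,m)$ is the directed graph whose nodes are the strings of $\Pi_n$ whose last symbol is at most $m$, with an arc from $\mathbf{a}$ to $\mathbf{b}$ whenever both are nodes and $\mathbf{b} = \mathbf{a}\sigma_r$ for some $r \in R$. A Hamilton sequence for such a graph with $N$ nodes is a sequence $r_1,\ldots,r_N$ of elements of $R$ such that, with $v_0 = n\,(n{ - }1)\cdots 1$ and $v_i = v_{i-1}\sigma_{r_i}$, the strings $v_0,\ldots,v_{N-1}$ are pairwise distinct and are exactly the nodes of the graph, and $v_N = v_0$. Recycle operation: for a sequence $S = r_1, r_2, \ldots$ and integer $k$, $\mathrm{recycle}_k(S)$ replaces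 each $r_i$ by $k, k$, then $k{ - }1$ repeated $r_i - 1$ times, then $k$ repeated $k - r_i - 1$ times. Canonical recycle sequences: $\mathcal{R}_1 = 1$ and $\mathcal{R}_k = \mathrm{recycle}_k(\mathcal{R}_{k-1})$ for $k>1$. Rewind operation: if $S = T, n{ - }1, n{ - }1$ is a sequence whose last two entries equal $n-1$ (its maximum), and $m \ge 2$, then $\mathrm{rewind}_m(S)$ is the concatenation of: $T, n{ - }1, n$; then $m-2$ copies of the block $T, n$; then $T, n{ - }1, n$; then $m-2$ copies of $n$. -}

module Defs where

open import Data.Nat using (ℕ; zero; suc; _∸_; _≤_)
open import Data.List using (List; []; _∷_; [_]; _++_; take; drop; map; upTo; downFrom; replicate; concat; concatMap; length)
open import Data.List.Membership.Propositional using (_∈_)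
open import Data.List.Relation.Unary.All using (All)
open import Data.List.Relation.Unary.Unique.Propositional using (Unique)
open import Data.List.Relation.Binary.Permutation.Propositional using (_↭_)
open import Data.Product using (Σ; ∃; ∃-syntax; _×_; _,_)
open import Relation.Binary.PropositionalEquality using (_≡_)

oneToN : ℕ → List ℕ
oneToN n = map suc (upTo n)

startString : ℕ → List ℕ
startString n = map suc (downFrom n)

InPi : ℕ → List ℕ → Set
InPi n a = a ↭ oneToN n

-- prefix rotation σ_r : a₁ ⋯ aₙ ↦ a₂ ⋯ a_r a₁ a_{r+1} ⋯ aₙ
rot : ℕ → List ℕ → List ℕ
rot r []       = []
rot r (x ∷ xs) = take (r ∸ 1) xs ++ (x ∷ drop (r ∸ 1) xs)

LastAtMost : ℕ → List ℕ → Set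
LastAtMost m a = ∃[ ys ] ∃[ k ] (a ≡ ys ++ [ k ] × k ≤ m)

IsNode : ℕ → ℕ → List ℕ → Set
IsNode n m a = InPi n a × LastAtMost m a

visited : List ℕ → List ℕ → List (List ℕ)
visited v []       = []
visited v (r ∷ rs) = v ∷ visited (rot r v) rs

final : List ℕ → List ℕ → List ℕ
final v []       = v
final v (r ∷ rs) = final (rot r v) rs

IsHamiltonSeq : ℕ → List ℕ → ℕ → List ℕ → Set
IsHamiltonSeq n R m rs =
  All (_∈ R) rs
  × Unique (visited (startString n) rs)
  × All (IsNode n m) (visited (startString n) rs)
  × (∀ a → IsNode n m a → a ∈ visited (startString n) rs)
  × final (startString n) rs ≡ startString n

recycle : ℕ → List ℕ → List ℕ
recycle k = concatMap (λ r → k ∷ k ∷ (replicate (r ∸ 1) (k ∸ 1) ++ replicate (k ∸ r ∸ 1) k))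

-- canonical recycle sequences 𝓡_k (k ≥ 1; the value at 0 is an unused dummy)
canonical : ℕ → List ℕ
canonical zero                = []
canonical (suc zero)          = 1 ∷ []
canonical (suc (suc k))       = recycle (suc (suc k)) (canonical (suc k))

-- rewind_m(S) for S = T, n-1, n-1 ; given as a function of T
rewindBody : ℕ → ℕ → List ℕ → List ℕ
rewindBody n m T =
  T ++ (n ∸ 1 ∷ n ∷ [])
  ++ concat (replicate (m ∸ 2) (T ++ [ n ]))
  ++ T ++ (n ∸ 1 ∷ n ∷ [])
  ++ replicate (m ∸ 2) n

moveFirstTwo : List ℕ → List ℕ
moveFirstTwo s = drop 2 s ++ take 2 s

module Submission where

-- The canonical recycle sequence 𝓡ₖ is a Hamilton cycle of the rotator graph on k-strings: a recycled
-- block run from a ∷ y visits the k strings in which the fresh symbol a occupies each position once and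
-- ends at a ∷ σ_r y, so recycling a cycle on (k−1)-strings gives a cycle on k-strings. Its rotation
-- S = T, n−1, n−1 is again a cycle; run on the first n−1 symbols with the last symbol frozen, it visits
-- the layer of all nodes ending in that symbol. Each σ_n moves the first symbol to the end and so
-- switches layers: in rewind_m(S) the passes T, n−1, n and T, n visit the layers ending in 1, …, m in
-- turn (the middle ones without their last node), and the trailing σ_n's collect those skipped nodes in
-- reverse order and return to n ⋯ 1.

open import Data.Empty using (⊥-elim)
open import Data.Nat using (ℕ; zero; suc; _+_; _∸_; _≤_; _<_; z≤n; s≤s; s≤s⁻¹; _⊓_)
open import Data.Nat.Properties
open import Data.List
  using (List; []; _∷_; [_]; _++_; _∷ʳ_; take; drop; map; length; concat; replicate;
         upTo; applyUpTo; applyDownFrom; initLast; _∷ʳ′_)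
open import Data.List.Properties
  using (++-assoc; ++-identityʳ; take++drop≡id; take-all; drop-all; length-++; length-take; length-drop;
         map-++; applyUpTo-∷ʳ; concat-++; reverse-applyUpTo; reverse-upTo;
         ∷-injective; ∷-injectiveˡ; ∷-injectiveʳ; ∷ʳ-injective; ∷ʳ-injectiveˡ; ∷ʳ-injectiveʳ)
open import Data.List.Membership.Propositional using (_∈_)
open import Data.List.Membership.Propositional.Properties
  using (∈-applyUpTo⁻; ∈-applyUpTo⁺; ∈-∃++; ∈-map⁺; ∈-map⁻; ∈-concat⁺′; ∈-++⁺ʳ)
open import Data.List.Relation.Unary.All using (All; []; _∷_)
import Data.List.Relation.Unary.All as All
import Data.List.Relation.Unary.All.Properties as All
open import Data.List.Relation.Unary.AllPairs using (AllPairs; []; _∷_)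
import Data.List.Relation.Unary.AllPairs.Properties as AllPairs
open import Data.List.Relation.Unary.Any using (here; there)
open import Data.List.Relation.Unary.Unique.Propositional using (Unique)
import Data.List.Relation.Unary.Unique.Propositional.Properties as Unique
open import Data.List.Relation.Binary.Disjoint.Propositional using (Disjoint)
open import Data.List.Relation.Binary.Permutation.Propositional
  using (_↭_; ↭-refl; ↭-sym; ↭-trans; ↭-prep; ↭-reflexive; ↭⇒↭ₛ; module PermutationReasoning)
open import Data.List.Relation.Binary.Permutation.Propositional.Properties
  using (shift; ↭-length; ∈-resp-↭; drop-mid; All-resp-↭; ↭-singleton-inv; ↭-reverse)
  renaming (++-comm to ↭-++-comm; ++⁺ˡ to ↭-++⁺ˡ; ++⁺ʳ to ↭-++⁺ʳ; map⁺ to ↭-map⁺)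
import Data.List.Relation.Binary.Permutation.Setoid.Properties as PermutationSetoid
open import Data.Product using (Σ; ∃-syntax; _×_; _,_; proj₁; proj₂)
open import Function using (_∘_)
import Relation.Binary.PropositionalEquality as ≡
open import Relation.Binary.PropositionalEquality
  using (_≡_; _≢_; refl; sym; trans; cong; cong₂; subst; subst₂; module ≡-Reasoning)

open import Defs

private
  variable
    A B : Set

take-++ˡ : ∀ n (xs ys : List A) → n ≤ length xs → take n (xs ++ ys) ≡ take n xs
take-++ˡ zero    xs       ys _       = refl
take-++ˡ (suc n) (x ∷ xs) ys (s≤s p) = cong (x ∷_) (take-++ˡ n xs ys p)

drop-++ˡ : ∀ n (xs ys : List A) → n ≤ length xs → drop n (xs ++ ys) ≡ drop n xs ++ ys
drop-++ˡ zero    xs       ys _       = refl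
drop-++ˡ (suc n) (x ∷ xs) ys (s≤s p) = drop-++ˡ n xs ys p

take-length-++ : ∀ (xs ys : List A) → take (length xs) (xs ++ ys) ≡ xs
take-length-++ []       ys = refl
take-length-++ (x ∷ xs) ys = cong (x ∷_) (take-length-++ xs ys)

drop-length-++ : ∀ (xs ys : List A) → drop (length xs) (xs ++ ys) ≡ ys
drop-length-++ []       ys = refl
drop-length-++ (x ∷ xs) ys = drop-length-++ xs ys

length-take-≤ : ∀ i (xs : List A) → i ≤ length xs → length (take i xs) ≡ i
length-take-≤ i xs i≤ = trans (length-take i xs) (m≤n⇒m⊓n≡m i≤)

length-∷ʳ : ∀ (xs : List A) x → length (xs ∷ʳ x) ≡ suc (length xs)
length-∷ʳ xs x = trans (length-++ xs) (+-comm (length xs) 1)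

length-take-cong : ∀ n (xs ys : List A) → length xs ≡ length ys → length (take n xs) ≡ length (take n ys)
length-take-cong n xs ys ∣xs∣ =
  trans (length-take n xs) (trans (cong (n ⊓_) ∣xs∣) (sym (length-take n ys)))

++-cancel-length : ∀ (as bs cs ds : List A) → length as ≡ length bs →
                   as ++ cs ≡ bs ++ ds → as ≡ bs × cs ≡ ds
++-cancel-length []       []       cs ds _    eq = refl , eq
++-cancel-length (a ∷ as) (b ∷ bs) cs ds ∣as∣ eq
  with refl , eq′ ← ∷-injective eq
  with refl , eq″ ← ++-cancel-length as bs cs ds (suc-injective ∣as∣) eq′
  = refl , eq″

drop-∷-take-∷ʳ : ∀ i (ys : List A) → i < length ys →
                 ∃[ q ] drop i ys ≡ q ∷ drop (suc i) ys × take (suc i) ys ≡ take i ys ∷ʳ q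
drop-∷-take-∷ʳ zero    (y ∷ ys) _       = y , refl , refl
drop-∷-take-∷ʳ (suc i) (y ∷ ys) (s≤s p) with q , d , t ← drop-∷-take-∷ʳ i ys p = q , d , cong (y ∷_) t

split-at-first : ∀ a (xs xs′ ys ys′ : List A) → All (a ≢_) xs → All (a ≢_) xs′ →
                 xs ++ a ∷ ys ≡ xs′ ++ a ∷ ys′ → xs ≡ xs′ × ys ≡ ys′
split-at-first a []       []         ys ys′ _          _            eq = refl , ∷-injectiveʳ eq
split-at-first a []       (x′ ∷ xs′) ys ys′ _          (a≢x′ ∷ _)   eq = ⊥-elim (a≢x′ (∷-injectiveˡ eq))
split-at-first a (x ∷ xs) []         ys ys′ (a≢x ∷ _)  _            eq = ⊥-elim (a≢x (sym (∷-injectiveˡ eq)))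
split-at-first a (x ∷ xs) (x′ ∷ xs′) ys ys′ (_ ∷ a∉)   (_ ∷ a∉′)    eq
  with refl , eq′ ← ∷-injective eq
  with refl , ys≡ ← split-at-first a xs xs′ ys ys′ a∉ a∉′ eq′
  = refl , ys≡

applyUpTo-cong : ∀ (f g : ℕ → A) n → (∀ {i} → i < n → f i ≡ g i) → applyUpTo f n ≡ applyUpTo g n
applyUpTo-cong f g zero    _  = refl
applyUpTo-cong f g (suc n) eq = cong₂ _∷_ (eq (s≤s z≤n)) (applyUpTo-cong (f ∘ suc) (g ∘ suc) n (eq ∘ s≤s))

concat-applyUpTo-∷ʳ : ∀ (f : ℕ → List A) (g : ℕ → A) n →
                      concat (applyUpTo (λ i → f i ∷ʳ g i) n) ↭ concat (applyUpTo f n) ++ applyUpTo g n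
concat-applyUpTo-∷ʳ f g zero    = ↭-refl
concat-applyUpTo-∷ʳ f g (suc n) = begin
  (f 0 ∷ʳ g 0) ++ concat (applyUpTo (λ i → f (suc i) ∷ʳ g (suc i)) n) ≡⟨ ++-assoc (f 0) [ g 0 ] _ ⟩
  f 0 ++ g 0 ∷ concat (applyUpTo (λ i → f (suc i) ∷ʳ g (suc i)) n)
    ↭⟨ ↭-++⁺ˡ (f 0) (↭-prep (g 0) (concat-applyUpTo-∷ʳ (f ∘ suc) (g ∘ suc) n)) ⟩
  f 0 ++ g 0 ∷ (concat (applyUpTo (f ∘ suc) n) ++ applyUpTo (g ∘ suc) n)
    ↭⟨ ↭-++⁺ˡ (f 0) (shift (g 0) (concat (applyUpTo (f ∘ suc) n)) (applyUpTo (g ∘ suc) n)) ⟨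
  f 0 ++ concat (applyUpTo (f ∘ suc) n) ++ g 0 ∷ applyUpTo (g ∘ suc) n ≡⟨ ++-assoc (f 0) _ _ ⟨
  concat (applyUpTo f (suc n)) ++ applyUpTo g (suc n) ∎
  where open PermutationReasoning

Unique-resp-↭ : {xs ys : List A} → xs ↭ ys → Unique xs → Unique ys
Unique-resp-↭ {A = A} p = PermutationSetoid.Unique-resp-↭ (≡.setoid A) (↭⇒↭ₛ p)

AllPairs-map⁺-on : {P : A → Set} {R : A → A → Set} {R′ : B → B → Set} (f : A → B) →
  (∀ {x y} → P x → P y → R x y → R′ (f x) (f y)) →
  ∀ {xs} → All P xs → AllPairs R xs → AllPairs R′ (map f xs)
AllPairs-map⁺-on f hom []         []         = []
AllPairs-map⁺-on {P = P} {R = R} {R′ = R′} f hom {x ∷ _} (px ∷ pxs) (rx ∷ rxs) =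
  map-head pxs rx ∷ AllPairs-map⁺-on f hom pxs rxs
  where
  map-head : ∀ {ys} → All P ys → All (R x) ys → All (R′ (f x)) (map f ys)
  map-head []         []         = []
  map-head (py ∷ pys) (ry ∷ rys) = hom px py ry ∷ map-head pys rys

map-∷ʳ-disjoint : ∀ {a b : A} {xs ys : List (List A)} → a ≢ b →
                  Disjoint (map (_∷ʳ a) xs) (map (_∷ʳ b) ys)
map-∷ʳ-disjoint {a = a} {b = b} a≢b (v∈ , v∈′)
  with x , _ , refl ← ∈-map⁻ (_∷ʳ a) v∈
  with y , _ , eq ← ∈-map⁻ (_∷ʳ b) v∈′
  = a≢b (∷ʳ-injectiveʳ x y eq)

-- Prefix rotations

Word : Set
Word = List ℕ

rot-↭ : ∀ r (xs : Word) → rot r xs ↭ xs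
rot-↭ r []       = ↭-refl
rot-↭ r (x ∷ xs) = ↭-trans (shift x (take (r ∸ 1) xs) (drop (r ∸ 1) xs))
                           (↭-prep x (↭-reflexive (take++drop≡id (r ∸ 1) xs)))

length-rot : ∀ r (xs : Word) → length (rot r xs) ≡ length xs
length-rot r xs = ↭-length (rot-↭ r xs)

rot-++ : ∀ r (xs ys : Word) → r ≤ length xs → rot r (xs ++ ys) ≡ rot r xs ++ ys
rot-++ zero []       []       _ = refl
rot-++ zero []       (y ∷ ys) _ = refl
rot-++ r    (x ∷ xs) ys       r≤ = begin
  take (r ∸ 1) (xs ++ ys) ++ x ∷ drop (r ∸ 1) (xs ++ ys)
    ≡⟨ cong₂ (λ a b → a ++ x ∷ b) (take-++ˡ (r ∸ 1) xs ys r∸1≤) (drop-++ˡ (r ∸ 1) xs ys r∸1≤) ⟩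
  take (r ∸ 1) xs ++ x ∷ (drop (r ∸ 1) xs ++ ys)
    ≡⟨ ++-assoc (take (r ∸ 1) xs) (x ∷ drop (r ∸ 1) xs) ys ⟨
  rot r (x ∷ xs) ++ ys ∎
  where
  open ≡-Reasoning
  r∸1≤ : r ∸ 1 ≤ length xs
  r∸1≤ = ∸-monoˡ-≤ 1 r≤

rot-∷-++ : ∀ {c} z (zs ys : Word) → length zs ≡ c → rot (suc c) (z ∷ zs ++ ys) ≡ zs ++ z ∷ ys
rot-∷-++ z zs ys refl = cong₂ (λ a b → a ++ z ∷ b) (take-length-++ zs ys) (drop-length-++ zs ys)

rot-∷ : ∀ {c} z (zs : Word) → length zs ≡ c → rot (suc c) (z ∷ zs) ≡ zs ∷ʳ z
rot-∷ {c} z zs ∣zs∣ = trans (cong (λ u → rot (suc c) (z ∷ u)) (sym (++-identityʳ zs))) (rot-∷-++ z zs [] ∣zs∣)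

rot-injective : ∀ r (xs ys : Word) → length xs ≡ length ys → rot r xs ≡ rot r ys → xs ≡ ys
rot-injective r []       []       _    _  = refl
rot-injective r (x ∷ xs) (y ∷ ys) ∣xs∣ eq
  with takes , eq′ ← ++-cancel-length (take (r ∸ 1) xs) (take (r ∸ 1) ys) _ _
                       (length-take-cong (r ∸ 1) xs ys (suc-injective ∣xs∣)) eq
  with refl , drops ← ∷-injective eq′
  = cong (x ∷_) (begin
      xs                                 ≡⟨ take++drop≡id (r ∸ 1) xs ⟨
      take (r ∸ 1) xs ++ drop (r ∸ 1) xs ≡⟨ cong₂ _++_ takes drops ⟩
      take (r ∸ 1) ys ++ drop (r ∸ 1) ys ≡⟨ take++drop≡id (r ∸ 1) ys ⟩
      ys ∎)
  where open ≡-Reasoning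

visited-++ : ∀ v (S S′ : Word) → visited v (S ++ S′) ≡ visited v S ++ visited (final v S) S′
visited-++ v []      S′ = refl
visited-++ v (r ∷ S) S′ = cong (v ∷_) (visited-++ (rot r v) S S′)

final-++ : ∀ v (S S′ : Word) → final v (S ++ S′) ≡ final (final v S) S′
final-++ v []      S′ = refl
final-++ v (r ∷ S) S′ = final-++ (rot r v) S S′

visited-↭ : ∀ v (S : Word) → All (_↭ v) (visited v S)
visited-↭ v []      = []
visited-↭ v (r ∷ S) = ↭-refl ∷ All.map (λ p → ↭-trans p (rot-↭ r v)) (visited-↭ (rot r v) S)

final-↭ : ∀ v (S : Word) → final v S ↭ v
final-↭ v []      = ↭-refl
final-↭ v (r ∷ S) = ↭-trans (final-↭ (rot r v) S) (rot-↭ r v)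

length-final : ∀ v (S : Word) → length (final v S) ≡ length v
length-final v S = ↭-length (final-↭ v S)

final-injective : ∀ (S xs ys : Word) → length xs ≡ length ys → final xs S ≡ final ys S → xs ≡ ys
final-injective []      xs ys _    eq = eq
final-injective (r ∷ S) xs ys ∣xs∣ eq = rot-injective r xs ys ∣xs∣
  (final-injective S (rot r xs) (rot r ys) (trans (length-rot r xs) (trans ∣xs∣ (sym (length-rot r ys)))) eq)

visited-++ʳ : ∀ {k} v s (S : Word) → length v ≡ k → All (_≤ k) S →
              visited (v ++ s) S ≡ map (_++ s) (visited v S)
visited-++ʳ v s []      _   []         = refl
visited-++ʳ v s (r ∷ S) ∣v∣ (r≤ ∷ S≤) = cong ((v ++ s) ∷_) (begin
  visited (rot r (v ++ s)) S   ≡⟨ cong (λ u → visited u S) (rot-++ r v s (subst (r ≤_) (sym ∣v∣) r≤)) ⟩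
  visited (rot r v ++ s) S     ≡⟨ visited-++ʳ (rot r v) s S (trans (length-rot r v) ∣v∣) S≤ ⟩
  map (_++ s) (visited (rot r v) S) ∎)
  where open ≡-Reasoning

final-++ʳ : ∀ {k} v s (S : Word) → length v ≡ k → All (_≤ k) S → final (v ++ s) S ≡ final v S ++ s
final-++ʳ v s []      _   []         = refl
final-++ʳ v s (r ∷ S) ∣v∣ (r≤ ∷ S≤) = begin
  final (rot r (v ++ s)) S   ≡⟨ cong (λ u → final u S) (rot-++ r v s (subst (r ≤_) (sym ∣v∣) r≤)) ⟩
  final (rot r v ++ s) S     ≡⟨ final-++ʳ (rot r v) s S (trans (length-rot r v) ∣v∣) S≤ ⟩
  final (rot r v) S ++ s ∎
  where open ≡-Reasoning

∈-visited : ∀ v S r S′ → v ∈ visited v (S ++ r ∷ S′)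
∈-visited v []      r S′ = here refl
∈-visited v (_ ∷ _) r S′ = here refl

record Traversal (v S : Word) (V : List Word) (w : Word) : Set where
  constructor traversal
  field
    visits : visited v S ≡ V
    ends   : final v S ≡ w

open Traversal public

traversal-++ : ∀ {v u w S S′ V V′} → Traversal v S V u → Traversal u S′ V′ w →
               Traversal v (S ++ S′) (V ++ V′) w
traversal-++ {v} {S = S} {S′} (traversal refl refl) (traversal refl refl) =
  traversal (visited-++ v S S′) (final-++ v S S′)

traversal-≡ : ∀ {v S V V′ w w′} → Traversal v S V w → V ≡ V′ → w ≡ w′ → Traversal v S V′ w′
traversal-≡ t refl refl = t

traversal-replicate : ∀ r (G : ℕ → Word) t → (∀ {i} → i < t → rot r (G i) ≡ G (suc i)) →
                      Traversal (G 0) (replicate t r) (applyUpTo G t) (G t)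
traversal-replicate r G zero    _    = traversal refl refl
traversal-replicate r G (suc t) step =
  traversal-++ {S = [ r ]} (traversal refl (step (s≤s z≤n))) (traversal-replicate r (G ∘ suc) t (step ∘ s≤s))

traversal-concat-replicate : ∀ (P : Word) (G : ℕ → Word) (V : ℕ → List Word) t →
  (∀ {i} → i < t → Traversal (G i) P (V i) (G (suc i))) →
  Traversal (G 0) (concat (replicate t P)) (concat (applyUpTo V t)) (G t)
traversal-concat-replicate P G V zero    _    = traversal refl refl
traversal-concat-replicate P G V (suc t) step =
  traversal-++ (step {0} (s≤s z≤n)) (traversal-concat-replicate P (G ∘ suc) (V ∘ suc) t (step ∘ s≤s))

-- Rotator cycles and recycling

record IsRotatorCycle (k : ℕ) (S : Word) : Set where
  field
    unique   : ∀ x → Unique x → length x ≡ k → Unique (visited x S)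
    complete : ∀ x → length x ≡ k → ∀ b → b ↭ x → b ∈ visited x S
    closed   : ∀ x → length x ≡ k → final x S ≡ x

module _ {k : ℕ} {P Q : Word} (cycle : IsRotatorCycle k (P ++ Q)) where
  open IsRotatorCycle cycle

  final-predecessor : ∀ w g → length w ≡ k → length g ≡ k → final g Q ≡ w → final w P ≡ g
  final-predecessor w g ∣w∣ ∣g∣ g→w = final-injective Q (final w P) g
    (trans (length-final w P) (trans ∣w∣ (sym ∣g∣)))
    (trans (sym (final-++ w P Q)) (trans (closed w ∣w∣) (sym g→w)))

  private
    module _ (x : Word) (∣x∣ : length x ≡ k) where
      w : Word
      w = final x Q

      ∣w∣ : length w ≡ k
      ∣w∣ = trans (length-final x Q) ∣x∣

      visited-swap : visited x (Q ++ P) ↭ visited w (P ++ Q)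
      visited-swap = begin
        visited x (Q ++ P)            ≡⟨ visited-++ x Q P ⟩
        visited x Q ++ visited w P    ↭⟨ ↭-++-comm (visited x Q) (visited w P) ⟩
        visited w P ++ visited x Q    ≡⟨ cong (λ u → visited w P ++ visited u Q)
                                            (sym (final-predecessor w x ∣w∣ ∣x∣ refl)) ⟩
        visited w P ++ visited (final w P) Q ≡⟨ visited-++ w P Q ⟨
        visited w (P ++ Q) ∎
        where open PermutationReasoning

  rotatorCycle-rotate : IsRotatorCycle k (Q ++ P)
  rotatorCycle-rotate = record
    { unique   = λ x ux ∣x∣ → Unique-resp-↭ (↭-sym (visited-swap x ∣x∣))
                   (unique (w x ∣x∣) (Unique-resp-↭ (↭-sym (final-↭ x Q)) ux) (∣w∣ x ∣x∣))
    ; complete = λ x ∣x∣ b b↭x → ∈-resp-↭ (↭-sym (visited-swap x ∣x∣))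
                   (complete (w x ∣x∣) (∣w∣ x ∣x∣) b (↭-trans b↭x (↭-sym (final-↭ x Q))))
    ; closed   = λ x ∣x∣ → trans (final-++ x Q P) (final-predecessor (w x ∣x∣) x (∣w∣ x ∣x∣) ∣x∣ refl)
    }

rotatorCycle-1 : IsRotatorCycle 1 [ 1 ]
rotatorCycle-1 = record
  { unique   = λ _ _ _ → [] ∷ []
  ; complete = λ { (x ∷ []) _ b b↭ → here (↭-singleton-inv b↭) }
  ; closed   = λ { (x ∷ []) _ → refl }
  }

-- The rotation lengths occurring in a canonical recycle sequence on (c+1)-strings: c+1, and c if c ≥ 1.
data Recyclable : ℕ → ℕ → Set where
  full    : ∀ c → Recyclable c (suc c)
  partial : ∀ c → Recyclable (suc c) (suc c)

recycleBlock : ℕ → ℕ → Word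
recycleBlock k r = k ∷ k ∷ (replicate (r ∸ 1) (k ∸ 1) ++ replicate (k ∸ r ∸ 1) k)

module Insertion (a : ℕ) where

  spliced : Word → ℕ → Word
  spliced []       i = []
  spliced (y ∷ ys) i = drop i ys ++ a ∷ (take i ys ∷ʳ y)

  -- The nodes visited by one recycled block from a ∷ z, in order: a sits at positions 0, |z|, |z|−1, …, 1.
  rowEntry : Word → ℕ → Word
  rowEntry z zero          = a ∷ z
  rowEntry z (suc zero)    = z ∷ʳ a
  rowEntry z (suc (suc i)) = spliced z i

  row : ℕ → Word → List Word
  row c z = applyUpTo (rowEntry z) (suc (suc c))

  rot-spliced : ∀ {c} y (ys : Word) → length ys ≡ c → ∀ {i} → suc i ≤ c →
                rot (suc c) (spliced (y ∷ ys) i) ≡ spliced (y ∷ ys) (suc i)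
  rot-spliced {c} y ys ∣ys∣ {i} i<c
    with q , drop≡ , take≡ ← drop-∷-take-∷ʳ i ys (subst (i <_) (sym ∣ys∣) i<c)
    rewrite drop≡ | take≡ = begin
      rot (suc c) (q ∷ (D ++ a ∷ (Tk ∷ʳ y)))
                                               ≡⟨ cong (λ u → rot (suc c) (q ∷ u)) (++-assoc D (a ∷ Tk) [ y ]) ⟨
      rot (suc c) (q ∷ (D ++ a ∷ Tk) ++ [ y ]) ≡⟨ rot-∷-++ q (D ++ a ∷ Tk) [ y ] ∣D++a∷Tk∣ ⟩
      (D ++ a ∷ Tk) ++ q ∷ [ y ]               ≡⟨ ++-assoc D (a ∷ Tk) (q ∷ [ y ]) ⟩
      D ++ a ∷ (Tk ++ q ∷ [ y ])               ≡⟨ cong (λ u → D ++ a ∷ u) (++-assoc Tk [ q ] [ y ]) ⟨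
      D ++ a ∷ (Tk ∷ʳ q ∷ʳ y) ∎
    where
    open ≡-Reasoning
    D Tk : Word
    D  = drop (suc i) ys
    Tk = take i ys
    ∣D++a∷Tk∣ : length (D ++ a ∷ Tk) ≡ c
    ∣D++a∷Tk∣ = begin
      length (D ++ a ∷ Tk)         ≡⟨ length-++ D ⟩
      length D + suc (length Tk)   ≡⟨ cong₂ (λ u v → u + suc v) (length-drop (suc i) ys)
                                        (length-take-≤ i ys (subst (i ≤_) (sym ∣ys∣) (<⇒≤ i<c))) ⟩
      length ys ∸ suc i + suc i    ≡⟨ cong (λ u → u ∸ suc i + suc i) ∣ys∣ ⟩
      c ∸ suc i + suc i            ≡⟨ m∸n+n≡m i<c ⟩
      c ∎

  block-prefix : ∀ {c} y (ys : Word) → length ys ≡ c → ∀ t → t ≤ c →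
    Traversal (a ∷ y ∷ ys) (suc (suc c) ∷ suc (suc c) ∷ replicate t (suc c))
              ((a ∷ y ∷ ys) ∷ ((y ∷ ys) ∷ʳ a) ∷ applyUpTo (spliced (y ∷ ys)) t) (spliced (y ∷ ys) t)
  block-prefix {c} y ys ∣ys∣ t t≤c =
    traversal-++ {S = K ∷ K ∷ []} (traversal (cong (λ u → (a ∷ y ∷ ys) ∷ u ∷ []) first) both)
    (traversal-replicate (suc c) (spliced (y ∷ ys)) t (λ i<t → rot-spliced y ys ∣ys∣ (≤-trans i<t t≤c)))
    where
    K : ℕ
    K = suc (suc c)
    first : rot K (a ∷ y ∷ ys) ≡ (y ∷ ys) ∷ʳ a
    first = rot-∷ a (y ∷ ys) (cong suc ∣ys∣)
    both : rot K (rot K (a ∷ y ∷ ys)) ≡ spliced (y ∷ ys) 0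
    both = trans (cong (rot K) first)
                 (trans (rot-∷ y (ys ∷ʳ a) (trans (length-∷ʳ ys a) (cong suc ∣ys∣))) (++-assoc ys [ a ] [ y ]))

  block : ∀ {c r} → Recyclable c r → ∀ y (ys : Word) → length ys ≡ c →
    Traversal (a ∷ y ∷ ys) (recycleBlock (suc (suc c)) r) (row c (y ∷ ys)) (a ∷ rot r (y ∷ ys))
  block (full c) y ys ∣ys∣ =
    subst (λ S → Traversal (a ∷ y ∷ ys) S (row c (y ∷ ys)) (a ∷ rot (suc c) (y ∷ ys))) (sym steps) (traversal-≡ (block-prefix y ys ∣ys∣ c ≤-refl) refl (begin
      spliced (y ∷ ys) c                  ≡⟨ cong₂ (λ u v → u ++ a ∷ (v ∷ʳ y)) (drop-all c ys (≤-reflexive ∣ys∣))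
                                                                                  (take-all c ys (≤-reflexive ∣ys∣)) ⟩
      a ∷ (ys ∷ʳ y)                       ≡⟨ cong (a ∷_) (rot-∷ y ys ∣ys∣) ⟨
      a ∷ rot (suc c) (y ∷ ys) ∎))
    where
    open ≡-Reasoning
    K : ℕ
    K = suc (suc c)
    steps : recycleBlock K (suc c) ≡ K ∷ K ∷ replicate c (suc c)
    steps = trans (cong (λ t → K ∷ K ∷ (replicate c (suc c) ++ replicate (t ∸ 1) K)) (m+n∸n≡m 1 c))
                  (cong (λ u → K ∷ K ∷ u) (++-identityʳ (replicate c (suc c))))
  block (partial c) y ys ∣ys∣ =
    subst (λ S → Traversal (a ∷ y ∷ ys) S (row (suc c) (y ∷ ys)) (a ∷ rot (suc c) (y ∷ ys))) (sym steps) (traversal-≡ (traversal-++ (block-prefix y ys ∣ys∣ c (n≤1+n c)) (traversal refl refl))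
      (cong (λ u → (a ∷ y ∷ ys) ∷ ((y ∷ ys) ∷ʳ a) ∷ u) (applyUpTo-∷ʳ (spliced (y ∷ ys)) c))
      (begin
        rot K (drop c ys ++ a ∷ (Tk ∷ʳ y))    ≡⟨ cong (λ u → rot K (u ++ a ∷ (Tk ∷ʳ y))) last ⟩
        rot K (q ∷ a ∷ (Tk ∷ʳ y))             ≡⟨ rot-∷ q (a ∷ (Tk ∷ʳ y)) (cong suc ∣Tk∷ʳy∣) ⟩
        a ∷ (Tk ∷ʳ y ∷ʳ q)                    ≡⟨ cong (a ∷_) (++-assoc Tk [ y ] [ q ]) ⟩
        a ∷ (Tk ++ y ∷ [ q ])                 ≡⟨ cong (λ u → a ∷ (Tk ++ y ∷ u)) last ⟨
        a ∷ rot (suc c) (y ∷ ys) ∎))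
    where
    open ≡-Reasoning
    K : ℕ
    K = suc (suc (suc c))
    Tk : Word
    Tk = take c ys
    steps : recycleBlock K (suc c) ≡ (K ∷ K ∷ replicate c (suc (suc c))) ++ [ K ]
    steps = cong (λ t → K ∷ K ∷ (replicate c (suc (suc c)) ++ replicate (t ∸ 1) K)) (m+n∸n≡m 2 c)
    split : ∃[ q ] drop c ys ≡ q ∷ drop (suc c) ys × take (suc c) ys ≡ take c ys ∷ʳ q
    split = drop-∷-take-∷ʳ c ys (≤-reflexive (sym ∣ys∣))
    q : ℕ
    q = proj₁ split
    last : drop c ys ≡ [ q ]
    last = trans (proj₁ (proj₂ split)) (cong (q ∷_) (drop-all (suc c) ys (≤-reflexive ∣ys∣)))
    ∣Tk∷ʳy∣ : length (Tk ∷ʳ y) ≡ suc c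
    ∣Tk∷ʳy∣ = trans (length-∷ʳ Tk y) (cong suc (length-take-≤ c ys (subst (c ≤_) (sym ∣ys∣) (n≤1+n c))))

  traversal-recycle : ∀ {c} (S : Word) → All (Recyclable c) S → ∀ y → length y ≡ suc c →
    Traversal (a ∷ y) (recycle (suc (suc c)) S) (concat (map (row c) (visited y S))) (a ∷ final y S)
  traversal-recycle []      []          y        _   = traversal refl refl
  traversal-recycle (r ∷ S) (rc ∷ S-rc) (y ∷ ys) ∣y∣ = traversal-++ (block rc y ys (suc-injective ∣y∣))
    (traversal-recycle S S-rc (rot r (y ∷ ys)) (trans (length-rot r (y ∷ ys)) ∣y∣))

  Fresh : ℕ → Word → Set
  Fresh c z = length z ≡ suc c × All (a ≢_) z

  -- As a ∉ z, the number of symbols after a in rowEntry z j determines j, and then z.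
  suffixLength : ℕ → ℕ → ℕ
  suffixLength c zero          = suc c
  suffixLength c (suc zero)    = zero
  suffixLength c (suc (suc i)) = suc i

  suffixLength-injective : ∀ {c j j′} → j < suc (suc c) → j′ < suc (suc c) →
                           suffixLength c j ≡ suffixLength c j′ → j ≡ j′
  suffixLength-injective {j = zero}        {zero}         _ _ _ = refl
  suffixLength-injective {j = zero}        {suc (suc i)}  _ (s≤s (s≤s i<c)) eq =
    ⊥-elim (<-irrefl (sym (suc-injective eq)) i<c)
  suffixLength-injective {j = suc zero}    {suc zero}     _ _ _ = refl
  suffixLength-injective {j = suc (suc i)} {zero}         (s≤s (s≤s i<c)) _ eq =
    ⊥-elim (<-irrefl (suc-injective eq) i<c)
  suffixLength-injective {j = suc (suc i)} {suc (suc i′)} _ _ eq = cong (suc ∘ suc) (suc-injective eq)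

  rowEntry-split : ∀ {c z} → Fresh c z → ∀ {j} → j < suc (suc c) →
    ∃[ pre ] ∃[ post ] rowEntry z j ≡ pre ++ a ∷ post × All (a ≢_) pre × length post ≡ suffixLength c j
  rowEntry-split {z = z} (∣z∣ , a∉z) {zero}     _ = [] , z , refl , [] , ∣z∣
  rowEntry-split {z = z} (∣z∣ , a∉z) {suc zero} _ = z , [] , refl , a∉z , refl
  rowEntry-split {c} {z₁ ∷ zs} (∣z∣ , _ ∷ a∉zs) {suc (suc i)} (s≤s (s≤s i<c)) =
    drop i zs , take i zs ∷ʳ z₁ , refl , All.drop⁺ i a∉zs ,
    trans (length-∷ʳ (take i zs) z₁)
          (cong suc (length-take-≤ i zs (subst (i ≤_) (sym (suc-injective ∣z∣)) (<⇒≤ i<c))))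

  rowEntry-injectiveʳ : ∀ {c z z′} → Fresh c z → Fresh c z′ → ∀ j →
                        rowEntry z j ≡ rowEntry z′ j → z ≡ z′
  rowEntry-injectiveʳ _ _ zero          eq = ∷-injectiveʳ eq
  rowEntry-injectiveʳ {z = z} {z′} _ _ (suc zero) eq = ∷ʳ-injectiveˡ z z′ eq
  rowEntry-injectiveʳ {z = z₁ ∷ zs} {z₁′ ∷ zs′} (∣z∣ , _ ∷ a∉zs) (∣z′∣ , _ ∷ a∉zs′) (suc (suc i)) eq
    with drops , eq′ ← split-at-first a (drop i zs) (drop i zs′) _ _
                                      (All.drop⁺ i a∉zs) (All.drop⁺ i a∉zs′) eq
    with takes , refl ← ∷ʳ-injective (take i zs) (take i zs′) eq′
    = cong (z₁ ∷_) (begin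
        zs                          ≡⟨ take++drop≡id i zs ⟨
        take i zs ++ drop i zs      ≡⟨ cong₂ _++_ takes drops ⟩
        take i zs′ ++ drop i zs′    ≡⟨ take++drop≡id i zs′ ⟩
        zs′ ∎)
    where open ≡-Reasoning

  rowEntry-injective : ∀ {c z z′ j j′} → Fresh c z → Fresh c z′ → j < suc (suc c) → j′ < suc (suc c) →
                       rowEntry z j ≡ rowEntry z′ j′ → j ≡ j′ × z ≡ z′
  rowEntry-injective {z = z} {z′} {j} {j′} fz fz′ j< j′< eq
    with pre , post , split , a∉pre , ∣post∣ ← rowEntry-split fz j<
    with pre′ , post′ , split′ , a∉pre′ , ∣post′∣ ← rowEntry-split fz′ j′<
    with _ , refl ← split-at-first a pre pre′ post post′ a∉pre a∉pre′ (trans (sym split) (trans eq split′))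
    with refl ← suffixLength-injective j< j′< (trans (sym ∣post∣) ∣post′∣)
    = refl , rowEntry-injectiveʳ fz fz′ j eq

  row-unique : ∀ {c z} → Fresh c z → Unique (row c z)
  row-unique {c} {z} fz = AllPairs.applyUpTo⁺₁ (rowEntry z) (suc (suc c))
    (λ i<j j< eq → <-irrefl (proj₁ (rowEntry-injective fz fz (<-trans i<j j<) j< eq)) i<j)

  row-disjoint : ∀ {c z z′} → Fresh c z → Fresh c z′ → z ≢ z′ → Disjoint (row c z) (row c z′)
  row-disjoint {z = z} {z′} fz fz′ z≢z′ (v∈ , v∈′)
    with j , j< , refl ← ∈-applyUpTo⁻ (rowEntry z) v∈
    with j′ , j′< , eq ← ∈-applyUpTo⁻ (rowEntry z′) v∈′
    = z≢z′ (proj₂ (rowEntry-injective fz fz′ j< j′< eq))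

  rowEntry-surjective : ∀ {c} y → length y ≡ suc c → ∀ b → b ↭ a ∷ y →
                        ∃[ z ] ∃[ j ] z ↭ y × j < suc (suc c) × b ≡ rowEntry z j
  rowEntry-surjective {c} y ∣y∣ b b↭
    with xs , ys , refl ← ∈-∃++ (∈-resp-↭ (↭-sym b↭) (here refl))
    = entry xs ys (drop-mid xs [] b↭)
    where
    entry : ∀ xs ys → xs ++ ys ↭ y → ∃[ z ] ∃[ j ] z ↭ y × j < suc (suc c) × xs ++ a ∷ ys ≡ rowEntry z j
    entry []       ys       p = ys , 0 , p , s≤s z≤n , refl
    entry (x ∷ xs) ys       p with initLast ys
    ... | []       = x ∷ xs , 1 , subst (_↭ y) (++-identityʳ (x ∷ xs)) p , s≤s (s≤s z≤n) , refl
    ... | P ∷ʳ′ z₁ = z₁ ∷ (P ++ X) , suc (suc (length P)) , z↭y , s≤s (s≤s ∣P∣<c) ,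
                     sym (cong₂ (λ u v → u ++ a ∷ (v ∷ʳ z₁)) (drop-length-++ P X) (take-length-++ P X))
      where
      X : Word
      X = x ∷ xs
      z↭y : z₁ ∷ (P ++ X) ↭ y
      z↭y = begin
        z₁ ∷ (P ++ X)      ↭⟨ shift z₁ P X ⟨
        P ++ [ z₁ ] ++ X   ≡⟨ ++-assoc P [ z₁ ] X ⟨
        (P ∷ʳ z₁) ++ X     ↭⟨ ↭-++-comm (P ∷ʳ z₁) X ⟩
        X ++ (P ∷ʳ z₁)     ↭⟨ p ⟩
        y ∎
        where open PermutationReasoning
      ∣P∣<c : length P < c
      ∣P∣<c = subst (length P <_)
        (suc-injective (trans (cong suc (sym (length-++ P))) (trans (↭-length z↭y) ∣y∣)))
        (m<m+n (length P) (s≤s z≤n))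

rotatorCycle-recycle : ∀ {c S} → IsRotatorCycle (suc c) S → All (Recyclable c) S →
                       IsRotatorCycle (suc (suc c)) (recycle (suc (suc c)) S)
rotatorCycle-recycle {c} {S} cycle S-rc = record
  { unique   = λ { (a ∷ y) (a∉y ∷ uy) ∣x∣ → subst Unique (sym (visits (recycled a y ∣x∣)))
                                                   (rows-unique a y (suc-injective ∣x∣) a∉y uy) }
  ; complete = λ { (a ∷ y) ∣x∣ b b↭ → subst (b ∈_) (sym (visits (recycled a y ∣x∣)))
                                            (rows-complete a y (suc-injective ∣x∣) b b↭) }
  ; closed   = λ { (a ∷ y) ∣x∣ → trans (ends (recycled a y ∣x∣))
                                        (cong (a ∷_) (closed y (suc-injective ∣x∣))) }
  }
  where
  open IsRotatorCycle cycle
  open Insertion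

  rows : ℕ → Word → List Word
  rows a y = concat (map (row a c) (visited y S))

  recycled : ∀ a y → length (a ∷ y) ≡ suc (suc c) →
             Traversal (a ∷ y) (recycle (suc (suc c)) S) (rows a y) (a ∷ final y S)
  recycled a y ∣x∣ = traversal-recycle a S S-rc y (suc-injective ∣x∣)

  fresh : ∀ {a y z} → All (a ≢_) y → length y ≡ suc c → z ↭ y → Fresh a c z
  fresh a∉y ∣y∣ z↭y = trans (↭-length z↭y) ∣y∣ , All-resp-↭ (↭-sym z↭y) a∉y

  rows-unique : ∀ a y → length y ≡ suc c → All (a ≢_) y → Unique y → Unique (rows a y)
  rows-unique a y ∣y∣ a∉y uy = Unique.concat⁺
    (All.map⁺ (All.map (λ z↭y → row-unique a (fresh a∉y ∣y∣ z↭y)) (visited-↭ y S)))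
    (AllPairs-map⁺-on (row a c)
      (λ z↭y z′↭y → row-disjoint a (fresh a∉y ∣y∣ z↭y) (fresh a∉y ∣y∣ z′↭y)) (visited-↭ y S) (unique y uy ∣y∣))

  rows-complete : ∀ a y → length y ≡ suc c → ∀ b → b ↭ a ∷ y → b ∈ rows a y
  rows-complete a y ∣y∣ b b↭ with z , j , z↭y , j< , refl ← rowEntry-surjective a y ∣y∣ b b↭ =
    ∈-concat⁺′ (∈-applyUpTo⁺ (rowEntry a z) j<) (∈-map⁺ (row a c) (complete y ∣y∣ z z↭y))

Recyclable-recycle : ∀ {c} (S : Word) → All (Recyclable (suc c)) (recycle (suc (suc c)) S)
Recyclable-recycle []      = []
Recyclable-recycle {c} (r ∷ S) =
  All.++⁺ (full _ ∷ full _ ∷ All.++⁺ (All.replicate⁺ (r ∸ 1) (partial c)) (All.replicate⁺ _ (full _)))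
          (Recyclable-recycle S)

canonical-rotatorCycle : ∀ c → IsRotatorCycle (suc c) (canonical (suc c)) × All (Recyclable c) (canonical (suc c))
canonical-rotatorCycle zero    = rotatorCycle-1 , full 0 ∷ []
canonical-rotatorCycle (suc c) =
  rotatorCycle-recycle (proj₁ (canonical-rotatorCycle c)) (proj₂ (canonical-rotatorCycle c)) ,
  Recyclable-recycle (canonical (suc c))

Recyclable-≤ : ∀ {c r} → Recyclable c r → r ≤ suc c
Recyclable-≤ (full c)    = ≤-refl
Recyclable-≤ (partial c) = n≤1+n (suc c)

Recyclable-∈ : ∀ {c r} xs → Recyclable c r → r ∈ c ∷ suc c ∷ xs
Recyclable-∈ xs (full c)    = there (here refl)
Recyclable-∈ xs (partial c) = here refl

canonical-∷ : ∀ c → ∃[ r ] ∃[ S ] canonical (suc c) ≡ r ∷ S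
canonical-∷ zero    = 1 , [] , refl
canonical-∷ (suc c) with r , S , eq ← canonical-∷ c rewrite eq = suc (suc c) , _ , refl

canonical-head : ∀ c → canonical (suc (suc c)) ≡ suc (suc c) ∷ suc (suc c) ∷ drop 2 (canonical (suc (suc c)))
canonical-head c with r , S , eq ← canonical-∷ c rewrite eq = refl

-- The rewind construction

descending : ℕ → ℕ → Word
descending lo zero    = []
descending lo (suc t) = suc (lo + t) ∷ descending lo t

descending-∷ʳ : ∀ lo t → descending lo (suc t) ≡ descending (suc lo) t ∷ʳ suc lo
descending-∷ʳ lo zero    = cong (λ x → [ suc x ]) (+-identityʳ lo)
descending-∷ʳ lo (suc t) = cong₂ _∷_ (cong suc (+-suc lo t)) (descending-∷ʳ lo t)

length-descending : ∀ lo t → length (descending lo t) ≡ t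
length-descending lo zero    = refl
length-descending lo (suc t) = cong suc (length-descending lo t)

startString-descending : ∀ t → startString t ≡ descending 0 t
startString-descending zero    = refl
startString-descending (suc t) = cong (suc t ∷_) (startString-descending t)

descending-unique : ∀ t → Unique (descending 0 t)
descending-unique t = subst Unique (startString-descending t) (Unique.map⁺ suc-injective (Unique.downFrom⁺ t))

descending-↭-oneToN : ∀ t → descending 0 t ↭ oneToN t
descending-↭-oneToN t = subst (_↭ oneToN t) (startString-descending t)
  (↭-map⁺ suc (↭-trans (↭-reflexive (sym (reverse-upTo t))) (↭-reverse (upTo t))))

-- For n = c + 3 and K = n − 1, layer j consists of the nodes ending in j + 1; with
-- core q u = q ⋯ 1 (q+2+u) ⋯ (q+3), its first and last nodes in the order of the rewind are
--   firstNode 0 = n ⋯ 2 1,                         lastNode 0 = 2 n ⋯ 3 1,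
--   firstNode (q+1) = q ⋯ 1 n ⋯ (q+3) (q+1) (q+2), lastNode (q+1) = (q+1) q ⋯ 1 n ⋯ (q+3) (q+2).
module Layers (c : ℕ) where

  K : ℕ
  K = suc (suc c)

  n : ℕ
  n = suc K

  core : ℕ → ℕ → Word
  core q u = descending 0 q ++ descending (suc (suc q)) u

  length-core : ∀ q u → length (core q u) ≡ q + u
  length-core q u = trans (length-++ (descending 0 q)) (cong₂ _+_ (length-descending 0 q) (length-descending _ u))

  length-core-≤ : ∀ {q} → q ≤ suc c → length (core q (suc c ∸ q)) ≡ suc c
  length-core-≤ {q} q≤ = trans (length-core q (suc c ∸ q)) (m+[n∸m]≡n q≤)

  core-shift : ∀ q u → suc q ∷ core q (suc u) ≡ core (suc q) u ∷ʳ suc (suc (suc q))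
  core-shift q u = cong (suc q ∷_) (begin
    descending 0 q ++ descending (suc (suc q)) (suc u)
      ≡⟨ cong (descending 0 q ++_) (descending-∷ʳ _ u) ⟩
    descending 0 q ++ (descending (suc (suc (suc q))) u ∷ʳ suc (suc (suc q)))
      ≡⟨ ++-assoc (descending 0 q) _ _ ⟨
    (descending 0 q ++ descending (suc (suc (suc q))) u) ∷ʳ suc (suc (suc q)) ∎)
    where open ≡-Reasoning

  start : ℕ → Word
  start zero    = descending 1 K
  start (suc q) = core q (suc c ∸ q) ∷ʳ suc q

  end : ℕ → Word
  end zero    = 2 ∷ descending 2 (suc c)
  end (suc q) = suc q ∷ core q (suc c ∸ q)

  penultimate : ℕ → Word
  penultimate q = suc (suc (suc q)) ∷ core (suc q) (c ∸ q)

  firstNode : ℕ → Word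
  firstNode j = start j ∷ʳ suc j

  lastNode : ℕ → Word
  lastNode j = end j ∷ʳ suc j

  length-end : ∀ {j} → j ≤ K → length (end j) ≡ K
  length-end {zero}  _        = cong suc (length-descending 2 (suc c))
  length-end {suc q} (s≤s q≤) = cong suc (length-core-≤ q≤)

  length-penultimate : ∀ {q} → q ≤ c → length (penultimate q) ≡ K
  length-penultimate q≤ = cong suc (length-core-≤ (s≤s q≤))

  rot-end : ∀ {j} → j ≤ K → rot K (end j) ≡ start j
  rot-end {zero}  _        = trans (rot-∷ 2 (descending 2 (suc c)) (length-descending 2 (suc c)))
                                   (sym (descending-∷ʳ 1 (suc c)))
  rot-end {suc q} (s≤s q≤) = rot-∷ (suc q) (core q (suc c ∸ q)) (length-core-≤ q≤)

  core-∷ʳ-end : ∀ {q} → q ≤ c → core (suc q) (c ∸ q) ∷ʳ suc (suc (suc q)) ≡ end (suc q)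
  core-∷ʳ-end {q} q≤ = trans (sym (core-shift q (c ∸ q)))
                             (cong (λ u → suc q ∷ core q u) (sym (+-∸-assoc 1 q≤)))

  rot-penultimate : ∀ {q} → q ≤ c → rot K (penultimate q) ≡ end (suc q)
  rot-penultimate {q} q≤ = trans (rot-∷ _ (core (suc q) (c ∸ q)) (length-core-≤ (s≤s q≤))) (core-∷ʳ-end q≤)

  length-core-∷ʳ : ∀ {q} → q ≤ c → ∀ x → length (core (suc q) (c ∸ q) ∷ʳ x) ≡ K
  length-core-∷ʳ {q} q≤ x = trans (length-∷ʳ (core (suc q) (c ∸ q)) x) (cong suc (length-core-≤ (s≤s q≤)))

  rot-penultimate-∷ʳ : ∀ {q} → q ≤ c → rot n (penultimate q ∷ʳ suc (suc q)) ≡ firstNode (suc (suc q))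
  rot-penultimate-∷ʳ {q} q≤ = rot-∷ _ (core (suc q) (c ∸ q) ∷ʳ suc (suc q)) (length-core-∷ʳ q≤ _)

  length-descending-∷ʳ : ∀ x → length (descending 2 (suc c) ∷ʳ x) ≡ K
  length-descending-∷ʳ x = trans (length-∷ʳ (descending 2 (suc c)) x) (cong suc (length-descending 2 (suc c)))

  firstNode-zero : descending 0 n ≡ firstNode 0
  firstNode-zero = descending-∷ʳ 0 K

  rot-lastNode-zero : rot n (lastNode 0) ≡ firstNode 1
  rot-lastNode-zero = rot-∷ 2 (descending 2 (suc c) ∷ʳ 1) (length-descending-∷ʳ 1)

  rot-lastNode : ∀ {q} → q ≤ c → rot n (lastNode (suc (suc q))) ≡ lastNode (suc q)
  rot-lastNode {q} q≤ = trans (rot-∷ _ (core (suc q) (c ∸ q) ∷ʳ suc (suc (suc q))) (length-core-∷ʳ q≤ _))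
                              (cong (_∷ʳ suc (suc q)) (core-∷ʳ-end q≤))

  rot-lastNode-one : rot n (lastNode 1) ≡ descending 0 n
  rot-lastNode-one = begin
    rot n (1 ∷ (descending 2 (suc c) ∷ʳ 2)) ≡⟨ rot-∷ 1 _ (length-descending-∷ʳ 2) ⟩
    descending 2 (suc c) ∷ʳ 2 ∷ʳ 1          ≡⟨ cong (_∷ʳ 1) (descending-∷ʳ 1 (suc c)) ⟨
    descending 1 K ∷ʳ 1                     ≡⟨ firstNode-zero ⟨
    descending 0 n ∎
    where open ≡-Reasoning

module Rewind (c : ℕ) (T : Word) (cycle : IsRotatorCycle (suc (suc c)) (T ++ suc (suc c) ∷ suc (suc c) ∷ []))
              (T≤K : All (_≤ suc (suc c)) T) where
  open Layers c
  open IsRotatorCycle cycle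

  length-start : ∀ {j} → j ≤ K → length (start j) ≡ K
  length-start {j} j≤ = trans (cong length (sym (rot-end j≤))) (trans (length-rot K (end j)) (length-end j≤))

  length-final-start : ∀ {j} → j ≤ K → length (final (start j) T) ≡ K
  length-final-start {j} j≤ = trans (length-final (start j) T) (length-start j≤)

  rot-final : ∀ {j} → j ≤ K → rot K (final (start j) T) ≡ end j
  rot-final {j} j≤ = rot-injective K (rot K (final (start j) T)) (end j)
    (trans (length-rot K (final (start j) T)) (trans (length-final-start j≤) (sym (length-end j≤))))
    (trans (sym (final-++ (start j) T (K ∷ K ∷ [])))
           (trans (closed (start j) (length-start j≤)) (sym (rot-end j≤))))

  final-T : ∀ {q} → q ≤ c → final (start (suc q)) T ≡ penultimate q
  final-T {q} q≤ = final-predecessor cycle (start (suc q)) (penultimate q) (length-start (s≤s (m≤n⇒m≤1+n q≤)))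
    (length-penultimate q≤) (trans (cong (rot K) (rot-penultimate q≤)) (rot-end (s≤s (m≤n⇒m≤1+n q≤))))

  layer : ℕ → List Word
  layer j = map (_∷ʳ suc j) (visited (start j) (T ++ K ∷ K ∷ []))

  layerInit : ℕ → List Word
  layerInit q = map (_∷ʳ suc (suc q)) (visited (start (suc q)) T) ∷ʳ (penultimate q ∷ʳ suc (suc q))

  traversal-frozen : ∀ {j} → j ≤ K →
    Traversal (firstNode j) T (map (_∷ʳ suc j) (visited (start j) T)) (final (start j) T ∷ʳ suc j)
  traversal-frozen {j} j≤ = traversal (visited-++ʳ (start j) [ suc j ] T (length-start j≤) T≤K)
                                      (final-++ʳ (start j) [ suc j ] T (length-start j≤) T≤K)

  rot-final-∷ʳ : ∀ {j} → j ≤ K → rot K (final (start j) T ∷ʳ suc j) ≡ lastNode j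
  rot-final-∷ʳ {j} j≤ = trans (rot-++ K (final (start j) T) [ suc j ] (≤-reflexive (sym (length-final-start j≤))))
                              (cong (_∷ʳ suc j) (rot-final j≤))

  layer-≡ : ∀ {j} → j ≤ K →
    layer j ≡ map (_∷ʳ suc j) (visited (start j) T) ++ (final (start j) T ∷ʳ suc j) ∷ lastNode j ∷ []
  layer-≡ {j} j≤ = begin
    map (_∷ʳ suc j) (visited w (T ++ K ∷ K ∷ []))
      ≡⟨ cong (map (_∷ʳ suc j)) (visited-++ w T (K ∷ K ∷ [])) ⟩
    map (_∷ʳ suc j) (visited w T ++ h ∷ rot K h ∷ [])
      ≡⟨ map-++ (_∷ʳ suc j) (visited w T) (h ∷ rot K h ∷ []) ⟩
    map (_∷ʳ suc j) (visited w T) ++ (h ∷ʳ suc j) ∷ (rot K h ∷ʳ suc j) ∷ []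
      ≡⟨ cong (λ u → map (_∷ʳ suc j) (visited w T) ++ (h ∷ʳ suc j) ∷ (u ∷ʳ suc j) ∷ []) (rot-final j≤) ⟩
    map (_∷ʳ suc j) (visited w T) ++ (h ∷ʳ suc j) ∷ lastNode j ∷ [] ∎
    where
    open ≡-Reasoning
    w h : Word
    w = start j
    h = final w T

  traversal-layer : ∀ {j} → j ≤ K → Traversal (firstNode j) (T ++ K ∷ n ∷ []) (layer j) (rot n (lastNode j))
  traversal-layer {j} j≤ = traversal-≡ (traversal-++ (traversal-frozen j≤) (traversal refl refl))
    (trans (cong (λ u → map (_∷ʳ suc j) (visited (start j) T) ++ (final (start j) T ∷ʳ suc j) ∷ u ∷ [])
                 (rot-final-∷ʳ j≤))
           (sym (layer-≡ j≤)))
    (cong (rot n) (rot-final-∷ʳ j≤))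

  traversal-layerInit : ∀ {q} → q ≤ c →
                        Traversal (firstNode (suc q)) (T ++ [ n ]) (layerInit q) (firstNode (suc (suc q)))
  traversal-layerInit {q} q≤ =
    traversal-≡ (traversal-++ (traversal-frozen (s≤s (m≤n⇒m≤1+n q≤))) (traversal refl refl))
    (cong (λ u → map (_∷ʳ suc (suc q)) (visited (start (suc q)) T) ∷ʳ (u ∷ʳ suc (suc q))) (final-T q≤))
    (trans (cong (λ u → rot n (u ∷ʳ suc (suc q))) (final-T q≤)) (rot-penultimate-∷ʳ q≤))

  layer-split : ∀ {q} → q ≤ c → layer (suc q) ≡ layerInit q ∷ʳ lastNode (suc q)
  layer-split {q} q≤ = trans (layer-≡ (s≤s (m≤n⇒m≤1+n q≤)))
    (trans (cong (λ u → V ++ (u ∷ʳ suc (suc q)) ∷ lastNode (suc q) ∷ []) (final-T q≤))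
           (sym (++-assoc V [ penultimate q ∷ʳ suc (suc q) ] [ lastNode (suc q) ])))
    where
    V : List Word
    V = map (_∷ʳ suc (suc q)) (visited (start (suc q)) T)

  traversal-descent : ∀ p → p ≤ suc c →
    Traversal (rot n (lastNode (suc p))) (replicate p n) (applyDownFrom (lastNode ∘ suc) p) (descending 0 n)
  traversal-descent zero    _  = traversal refl rot-lastNode-one
  traversal-descent (suc p) p≤ =
    subst (λ v → Traversal v (replicate (suc p) n) (applyDownFrom (lastNode ∘ suc) (suc p)) (descending 0 n))
      (sym (rot-lastNode (s≤s⁻¹ p≤)))
      (traversal-++ {S = [ n ]} (traversal refl refl) (traversal-descent p (m≤n⇒m≤1+n (s≤s⁻¹ p≤))))

  rewindNodes : ℕ → List Word
  rewindNodes p = layer 0 ++ concat (applyUpTo layerInit p) ++ layer (suc p) ++ applyDownFrom (lastNode ∘ suc) p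

  rewindBody-≡ : ∀ p → rewindBody n (suc (suc p)) T
                   ≡ (T ++ K ∷ n ∷ []) ++ concat (replicate p (T ++ [ n ])) ++ (T ++ K ∷ n ∷ []) ++ replicate p n
  rewindBody-≡ p = trans (cong (λ u → T ++ K ∷ n ∷ (concat (replicate p (T ++ [ n ])) ++ u))
                               (sym (++-assoc T (K ∷ n ∷ []) (replicate p n))))
                         (sym (++-assoc T (K ∷ n ∷ []) _))

  traversal-rewind : ∀ {p} → p ≤ suc c →
                     Traversal (descending 0 n) (rewindBody n (suc (suc p)) T) (rewindNodes p) (descending 0 n)
  traversal-rewind {p} p≤ =
    subst (λ S → Traversal (descending 0 n) S (rewindNodes p) (descending 0 n)) (sym (rewindBody-≡ p))
      (traversal-++ first (traversal-++ middle (traversal-++ (traversal-layer (s≤s p≤)) (traversal-descent p p≤))))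
    where
    first : Traversal (descending 0 n) (T ++ K ∷ n ∷ []) (layer 0) (firstNode 1)
    first = subst (λ v → Traversal v (T ++ K ∷ n ∷ []) (layer 0) (firstNode 1)) (sym firstNode-zero)
              (traversal-≡ (traversal-layer z≤n) refl rot-lastNode-zero)
    middle : Traversal (firstNode 1) (concat (replicate p (T ++ [ n ]))) (concat (applyUpTo layerInit p))
                       (firstNode (suc p))
    middle = traversal-concat-replicate (T ++ [ n ]) (firstNode ∘ suc) layerInit p
               (λ q<p → traversal-layerInit (s≤s⁻¹ (≤-trans q<p p≤)))

  rewindNodes-↭ : ∀ {p} → p ≤ suc c → rewindNodes p ↭ concat (applyUpTo layer (suc (suc p)))
  rewindNodes-↭ {p} p≤ = ↭-++⁺ˡ (layer 0) (begin
    concat (applyUpTo layerInit p) ++ layer (suc p) ++ applyDownFrom (lastNode ∘ suc) p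
      ↭⟨ ↭-++⁺ˡ (concat (applyUpTo layerInit p)) (↭-++-comm (layer (suc p)) _) ⟩
    concat (applyUpTo layerInit p) ++ applyDownFrom (lastNode ∘ suc) p ++ layer (suc p)
      ≡⟨ ++-assoc (concat (applyUpTo layerInit p)) _ _ ⟨
    (concat (applyUpTo layerInit p) ++ applyDownFrom (lastNode ∘ suc) p) ++ layer (suc p)
      ↭⟨ ↭-++⁺ʳ (layer (suc p)) (↭-++⁺ˡ (concat (applyUpTo layerInit p)) descent↭) ⟩
    (concat (applyUpTo layerInit p) ++ applyUpTo (lastNode ∘ suc) p) ++ layer (suc p)
      ↭⟨ ↭-++⁺ʳ (layer (suc p)) (concat-applyUpTo-∷ʳ layerInit (lastNode ∘ suc) p) ⟨
    concat (applyUpTo (λ q → layerInit q ∷ʳ lastNode (suc q)) p) ++ layer (suc p)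
      ≡⟨ cong (λ u → concat u ++ layer (suc p))
              (applyUpTo-cong _ (layer ∘ suc) p (λ q<p → sym (layer-split (s≤s⁻¹ (≤-trans q<p p≤))))) ⟩
    concat (applyUpTo (layer ∘ suc) p) ++ layer (suc p)
      ≡⟨ cong (concat (applyUpTo (layer ∘ suc) p) ++_) (++-identityʳ (layer (suc p))) ⟨
    concat (applyUpTo (layer ∘ suc) p) ++ concat [ layer (suc p) ]
      ≡⟨ concat-++ (applyUpTo (layer ∘ suc) p) [ layer (suc p) ] ⟩
    concat (applyUpTo (layer ∘ suc) p ∷ʳ layer (suc p))
      ≡⟨ cong concat (applyUpTo-∷ʳ (layer ∘ suc) p) ⟩
    concat (applyUpTo (layer ∘ suc) (suc p)) ∎)
    where
    open PermutationReasoning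
    descent↭ : applyDownFrom (lastNode ∘ suc) p ↭ applyUpTo (lastNode ∘ suc) p
    descent↭ = ↭-trans (↭-reflexive (sym (reverse-applyUpTo (lastNode ∘ suc) p))) (↭-reverse _)

  module _ {p} (p≤ : p ≤ suc c) where

    m : ℕ
    m = suc (suc p)

    layers : List Word
    layers = concat (applyUpTo layer m)

    <m⇒≤K : ∀ {j} → j < m → j ≤ K
    <m⇒≤K j<m = ≤-trans (s≤s⁻¹ j<m) (s≤s p≤)

    layers-↭ : layers ↭ visited (descending 0 n) (rewindBody n m T)
    layers-↭ = ↭-sym (↭-trans (↭-reflexive (visits (traversal-rewind p≤))) (rewindNodes-↭ p≤))

    -- firstNode j is visited by the rewind, and every visited string is a rearrangement of n ⋯ 1.
    firstNode-↭ : ∀ {j} → j < m → firstNode j ↭ descending 0 n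
    firstNode-↭ {j} j<m = All.lookup (All-resp-↭ (↭-sym layers-↭) (visited-↭ (descending 0 n) (rewindBody n m T)))
      (∈-concat⁺′ (∈-map⁺ (_∷ʳ suc j) (∈-visited (start j) T K (K ∷ []))) (∈-applyUpTo⁺ layer j<m))

    start-unique : ∀ {j} → j < m → Unique (start j)
    start-unique {j} j<m = subst Unique (take-length-++ (start j) [ suc j ])
      (Unique.take⁺ (length (start j)) (Unique-resp-↭ (↭-sym (firstNode-↭ j<m)) (descending-unique n)))

    layer-unique : ∀ {j} → j < m → Unique (layer j)
    layer-unique {j} j<m = Unique.map⁺ (λ {x} {y} → ∷ʳ-injectiveˡ x y)
      (unique (start j) (start-unique j<m) (length-start (<m⇒≤K j<m)))

    layers-unique : Unique layers
    layers-unique = Unique.concat⁺ (All.applyUpTo⁺₁ layer m layer-unique)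
      (AllPairs.applyUpTo⁺₁ layer m (λ i<j _ → map-∷ʳ-disjoint (<⇒≢ (s≤s i<j))))

    layer-nodes : ∀ {j} → j < m → All (IsNode n m) (layer j)
    layer-nodes {j} j<m = All.map⁺ (All.map node (visited-↭ (start j) (T ++ K ∷ K ∷ [])))
      where
      node : ∀ {z} → z ↭ start j → IsNode n m (z ∷ʳ suc j)
      node z↭ = ↭-trans (↭-++⁺ʳ [ suc j ] z↭) (↭-trans (firstNode-↭ j<m) (descending-↭-oneToN n)) ,
                _ , suc j , refl , j<m

    layers-nodes : All (IsNode n m) layers
    layers-nodes = All.concat⁺ (All.applyUpTo⁺₁ layer m layer-nodes)

    layers-complete : ∀ b → IsNode n m b → b ∈ layers
    layers-complete b (b↭ , ys , k , refl , k≤m)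
      with j , _ , refl ← ∈-map⁻ suc (∈-resp-↭ b↭ (∈-++⁺ʳ ys (here refl))) =
      ∈-concat⁺′ (∈-map⁺ (_∷ʳ suc j) (complete (start j) (length-start (<m⇒≤K k≤m)) ys ys↭))
                 (∈-applyUpTo⁺ layer k≤m)
      where
      ys↭ : ys ↭ start j
      ys↭ = subst₂ _↭_ (++-identityʳ ys) (++-identityʳ (start j)) (drop-mid ys (start j)
              (↭-trans b↭ (↭-trans (↭-sym (descending-↭-oneToN n)) (↭-sym (firstNode-↭ k≤m)))))

    rewind-hamiltonian : All (_∈ suc c ∷ K ∷ n ∷ []) T →
                         IsHamiltonSeq n (suc c ∷ K ∷ n ∷ []) m (rewindBody n m T)
    rewind-hamiltonian T∈ rewrite startString-descending n =
      entries ,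
      Unique-resp-↭ layers-↭ layers-unique ,
      All-resp-↭ layers-↭ layers-nodes ,
      (λ b b-node → ∈-resp-↭ layers-↭ (layers-complete b b-node)) ,
      ends (traversal-rewind p≤)
      where
      K∈ : K ∈ suc c ∷ K ∷ n ∷ []
      K∈ = there (here refl)
      n∈ : n ∈ suc c ∷ K ∷ n ∷ []
      n∈ = there (there (here refl))
      entries : All (_∈ suc c ∷ K ∷ n ∷ []) (rewindBody n m T)
      entries = All.++⁺ T∈ (K∈ ∷ n∈ ∷ All.++⁺ (All.concat⁺ (All.replicate⁺ p (All.++⁺ T∈ (n∈ ∷ []))))
                                              (All.++⁺ T∈ (K∈ ∷ n∈ ∷ All.replicate⁺ p n∈)))

theorem8 : (n : ℕ) → 4 ≤ n → (m : ℕ) → 2 ≤ m → m ≤ n →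
    Σ (List ℕ) (λ T →
      moveFirstTwo (canonical (n ∸ 1)) ≡ T ++ (n ∸ 1 ∷ n ∸ 1 ∷ [])
      × IsHamiltonSeq n (n ∸ 2 ∷ n ∸ 1 ∷ n ∷ []) m (rewindBody n m T))
theorem8 (suc (suc (suc (suc c)))) (s≤s (s≤s (s≤s (s≤s _)))) (suc (suc p)) (s≤s (s≤s _)) (s≤s (s≤s p≤)) =
  T , cong (T ++_) (cong (take 2) head) ,
  Rewind.rewind-hamiltonian (suc c) T cycle (All.map Recyclable-≤ T-rc) p≤ (All.map (Recyclable-∈ _) T-rc)
  where
  K : ℕ
  K = suc (suc (suc c))
  T : Word
  T = drop 2 (canonical K)
  head : canonical K ≡ K ∷ K ∷ T
  head = canonical-head (suc c)
  canonical-cycle : IsRotatorCycle K (K ∷ K ∷ T) × All (Recyclable (suc (suc c))) (K ∷ K ∷ T)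
  canonical-cycle = subst (λ S → IsRotatorCycle K S × All (Recyclable (suc (suc c))) S) head
                          (canonical-rotatorCycle (suc (suc c)))
  cycle : IsRotatorCycle K (T ++ K ∷ K ∷ [])
  cycle = rotatorCycle-rotate {P = K ∷ K ∷ []} (proj₁ canonical-cycle)
  T-rc : All (Recyclable (suc (suc c))) T
  T-rc with _ ∷ _ ∷ rc ← proj₂ canonical-cycle = rc
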